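{- For $n\ge 0$ let \[ S_n=\sum_{k=0}^{\lfloor n/2\rfloor}(-1)^k \binom{n-k}{k}_q q^{k(k-1)/2}. \] Then for all integers $n\ge 2$, \[ S_n = q^{\lfloor n/3\rfloor} S_{n-1} - q^{\lfloor 2n/3\rfloor - 1} S_{n-2}. \]
   Context: The $q$-binomial coefficient is $\binom{m}{k}_q=\frac{[m][m-1]\cdots[m-k+1]}{[1][2]\cdots[k]}$ for $k\in\mathbb{N}$, $\binom{m}{0}_q=1$, where $[m]=(1-q^m)/(1-q)$. -}

module Defs where

open import Level using (Level)
open import Algebra.Bundles using (CommutativeRing)
open import Data.Nat as ℕ using (ℕ; zero; suc)
open import Data.Nat.DivMod using (_/_)

-- All definitions are relative to a commutative ring R and an element q of R.
-- (Taking R = ℤ[q] recovers the identity of formal polynomials in q.)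
module QDefs {c ℓ : Level} (R : CommutativeRing c ℓ) (q : CommutativeRing.Carrier R) where
  open CommutativeRing R

  pow : Carrier → ℕ → Carrier
  pow x zero    = 1#
  pow x (suc n) = x * pow x n

  sgn : ℕ → Carrier
  sgn zero    = 1#
  sgn (suc k) = - sgn k

  -- Gaussian (q-)binomial coefficient  [m choose k]_q, the polynomial
  -- [m][m-1]...[m-k+1] / ([1]...[k]), given by the q-Pascal recurrence
  --   [m+1 choose k+1] = [m choose k] + q^(k+1) [m choose k+1],
  -- with [m choose 0] = 1 and [0 choose k+1] = 0.
  qbinom : ℕ → ℕ → Carrier
  qbinom m       zero    = 1#
  qbinom zero    (suc k) = 0#
  qbinom (suc m) (suc k) = qbinom m k + pow q (suc k) * qbinom m (suc k)

  sumTo : ℕ → (ℕ → Carrier) → Carrier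
  sumTo zero    f = f 0
  sumTo (suc K) f = sumTo K f + f (suc K)

  S : ℕ → Carrier
  S n = sumTo (n / 2) (λ k → sgn k * qbinom (n ℕ.∸ k) k * pow q ((k ℕ.* (k ℕ.∸ 1)) / 2))

{-# OPTIONS --safe #-}
-- Sum to n rather than to ⌊n/2⌋ (the extra terms vanish) and call this sum T n; let U n be
-- the same sum with q^(k(k+1)/2) in place of q^(k(k-1)/2). The two q-Pascal rules give
--   T (m+2) = U (m+1) - U m   and   U (m+2) = U (m+1) - q^(m+1) T m,
-- hence T (m+3) = - q^(m+1) T m. Along n ↦ n+3 this multiplier gains one factor q, while the
-- exponents ⌊n/3⌋ and ⌊2n/3⌋ - 1 of the recurrence gain 1 and 2, so the recurrence propagates
-- from n = 2, 3, 4, where it is checked on T 0, …, T 4 = 1, 1, 0, -q, -q².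
module Submission where

open import Defs
open import Level using (Level)
open import Algebra.Bundles using (CommutativeRing)
open import Data.Nat as ℕ using (ℕ; zero; suc; _≤_; _<_; _≤′_; ≤′-reflexive; ≤′-step; z≤n; s≤s)
open import Data.Nat.DivMod using (_/_; _%_; m≡m%n+[m/n]*n; m%n<n; m/n≤m; m/n≡1+[m∸n]/n; m*n/n≡m)
open import Data.Nat.Properties
  using (n<1+n; <⇒≤; +-suc; ≤⇒≤′; ≤′⇒≤; m∸n≤m; 0∸n≡0; m<n⇒m<1+n; m<n+o⇒m∸n<o; m≤n+o⇒m∸n≤o; m≤n⇒∃[o]m+o≡n;
         _≤?_; ≰⇒>)
import Data.Nat.Properties as ℕₚ
open import Data.Product using (_,_)
open import Relation.Binary.PropositionalEquality as ≡ using (_≡_; cong)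
open import Relation.Nullary using (yes; no; contradiction)

triangle : ℕ → ℕ
triangle zero    = 0
triangle (suc k) = k ℕ.+ triangle k

triangle⁺ : ℕ → ℕ
triangle⁺ k = triangle (suc k)

module _ where
  open import Data.Nat using (_+_; _*_; _∸_)
  open import Data.Nat.Properties
    using (≤-trans; m≤m+n; +-∸-assoc; +-assoc; +-suc; +-comm; *-comm; +-identityʳ; *-distribʳ-+; *-distribˡ-+;
           +-monoˡ-<; *-monoˡ-≤; m+n∸m≡n; module ≤-Reasoning)

  k*[k∸1]/2≡triangle : ∀ k → k * (k ∸ 1) / 2 ≡ triangle k
  k*[k∸1]/2≡triangle k = ≡.trans (cong (_/ 2) (k*[k∸1]≡triangle*2 k)) (m*n/n≡m (triangle k) 2)
    where
    open ≡.≡-Reasoning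
    open import Data.Nat.Tactic.RingSolver using (solve-∀)

    [2+i]*[1+i]≡[1+i]*i+[1+i]*2 : ∀ i → (2 + i) * (1 + i) ≡ (1 + i) * i + (1 + i) * 2
    [2+i]*[1+i]≡[1+i]*i+[1+i]*2 = solve-∀

    k*[k∸1]≡triangle*2 : ∀ k → k * (k ∸ 1) ≡ triangle k * 2
    k*[k∸1]≡triangle*2 zero          = ≡.refl
    k*[k∸1]≡triangle*2 (suc zero)    = ≡.refl
    k*[k∸1]≡triangle*2 (suc (suc i)) = begin
      (2 + i) * (1 + i)                         ≡⟨ [2+i]*[1+i]≡[1+i]*i+[1+i]*2 i ⟩
      (1 + i) * i + (1 + i) * 2                 ≡⟨ cong (_+ (1 + i) * 2) (k*[k∸1]≡triangle*2 (suc i)) ⟩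
      triangle (1 + i) * 2 + (1 + i) * 2        ≡⟨ *-distribʳ-+ 2 (triangle (1 + i)) (1 + i) ⟨
      (triangle (1 + i) + (1 + i)) * 2          ≡⟨ cong (_* 2) (+-comm (triangle (1 + i)) (1 + i)) ⟩
      triangle (2 + i) * 2                      ∎

  [3+m]/3≡1+[m/3] : ∀ m → (3 + m) / 3 ≡ suc (m / 3)
  [3+m]/3≡1+[m/3] m = m/n≡1+[m∸n]/n (m≤m+n 3 m)

  [2*[5+k]]/3∸1≡2+[[2*[2+k]]/3∸1] : ∀ k → 2 * (5 + k) / 3 ∸ 1 ≡ 2 + (2 * (2 + k) / 3 ∸ 1)
  [2*[5+k]]/3∸1≡2+[[2*[2+k]]/3∸1] k = begin
    2 * (5 + k) / 3 ∸ 1               ≡⟨ cong (λ x → x / 3 ∸ 1) (*-distribˡ-+ 2 3 (2 + k)) ⟩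
    (3 + (3 + 2 * (2 + k))) / 3 ∸ 1   ≡⟨ cong (_∸ 1) ([3+m]/3≡1+[m/3] (3 + 2 * (2 + k))) ⟩
    (3 + 2 * (2 + k)) / 3             ≡⟨ [3+m]/3≡1+[m/3] (2 * (2 + k)) ⟩
    suc (2 * (2 + k) / 3)             ≡⟨ cong suc [2*[2+k]]/3≡1+[[1+2*k]/3] ⟩
    suc (suc ((1 + 2 * k) / 3))       ≡⟨ cong (λ x → 2 + (x ∸ 1)) [2*[2+k]]/3≡1+[[1+2*k]/3] ⟨
    2 + (2 * (2 + k) / 3 ∸ 1)         ∎
    where
    open ≡.≡-Reasoning
    [2*[2+k]]/3≡1+[[1+2*k]/3] : 2 * (2 + k) / 3 ≡ suc ((1 + 2 * k) / 3)
    [2*[2+k]]/3≡1+[[1+2*k]/3] = ≡.trans (cong (_/ 3) (*-distribˡ-+ 2 2 k)) ([3+m]/3≡1+[m/3] (1 + 2 * k))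

  m/2<n⇒m∸n<n : ∀ {m n} → m / 2 < n → m ∸ n < n
  m/2<n⇒m∸n<n {m} {n@(suc _)} m/2<n = m<n+o⇒m∸n<o m n (begin-strict
    m                     ≡⟨ m≡m%n+[m/n]*n m 2 ⟩
    m % 2 + m / 2 * 2     <⟨ +-monoˡ-< (m / 2 * 2) (m%n<n m 2) ⟩
    suc (m / 2) * 2       ≤⟨ *-monoˡ-≤ 2 m/2<n ⟩
    n * 2                 ≡⟨ *-comm n 2 ⟩
    n + (n + 0)           ≡⟨ cong (n +_) (+-identityʳ n) ⟩
    n + n                 ∎)
    where open ≤-Reasoning

  [m+m+n]∸m≡n+m : ∀ m n → m + m + n ∸ m ≡ n + m
  [m+m+n]∸m≡n+m m n = ≡.trans (cong (_∸ m) (+-assoc m m n)) (≡.trans (m+n∸m≡n m (m + n)) (+-comm m n))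

  [1+m+m+n]∸m≡1+n+m : ∀ m n → suc (m + m + n) ∸ m ≡ suc (n + m)
  [1+m+m+n]∸m≡1+n+m m n =
    ≡.trans (+-∸-assoc 1 (≤-trans (m≤m+n m m) (m≤m+n (m + m) n))) (cong suc ([m+m+n]∸m≡n+m m n))

module _ {c ℓ : Level} (R : CommutativeRing c ℓ) (q : CommutativeRing.Carrier R) where
  open CommutativeRing R hiding (zero)
  open QDefs R q
  open import Algebra.Properties.Ring ring using (-1*x≈-x)
  open import Algebra.Properties.Group +-group using (//-rightDividesʳ)
  open import Algebra.Solver.Ring.NaturalCoefficients.Default commutativeSemiring
    using (solve; _:+_; _:*_; _:=_; con)
  open import Relation.Binary.Reasoning.Setoid setoid

  pow-+ : ∀ x m n → pow x (m ℕ.+ n) ≈ pow x m * pow x n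
  pow-+ x zero    n = sym (*-identityˡ _)
  pow-+ x (suc m) n = trans (*-congˡ (pow-+ x m n)) (sym (*-assoc _ _ _))

  -- A name for -1 lets the semiring solver treat the signs as an atom.
  -1# : Carrier
  -1# = - 1#

  sgn-suc : ∀ k → sgn (suc k) ≈ -1# * sgn k
  sgn-suc k = sym (-1*x≈-x (sgn k))

  x+-1#*x≈0# : ∀ x → x + -1# * x ≈ 0#
  x+-1#*x≈0# x = trans (+-congˡ (-1*x≈-x x)) (-‿inverseʳ x)

  sumTo-cong : ∀ N {f g : ℕ → Carrier} → (∀ k → f k ≈ g k) → sumTo N f ≈ sumTo N g
  sumTo-cong zero    f≈g = f≈g 0
  sumTo-cong (suc N) f≈g = +-cong (sumTo-cong N f≈g) (f≈g (suc N))

  sumTo-suc : ∀ N (f : ℕ → Carrier) → sumTo (suc N) f ≈ f 0 + sumTo N (λ j → f (suc j))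
  sumTo-suc zero    f = refl
  sumTo-suc (suc N) f = trans (+-congʳ (sumTo-suc N f)) (+-assoc _ _ _)

  sumTo-linear : ∀ N (f g : ℕ → Carrier) a → sumTo N (λ j → f j + a * g j) ≈ sumTo N f + a * sumTo N g
  sumTo-linear zero    f g a = refl
  sumTo-linear (suc N) f g a = trans (+-congʳ (sumTo-linear N f g a))
    (solve 5 (λ F G x y a → (F :+ a :* G) :+ (x :+ a :* y) := (F :+ x) :+ a :* (G :+ y)) refl
       (sumTo N f) (sumTo N g) (f (suc N)) (g (suc N)) a)

  sumTo-suc-vanish : ∀ N {f : ℕ → Carrier} → f (suc N) ≈ 0# → sumTo (suc N) f ≈ sumTo N f
  sumTo-suc-vanish N f[1+N]≈0 = trans (+-congˡ f[1+N]≈0) (+-identityʳ _)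

  sumTo-vanishing-tail : ∀ {N M} (f : ℕ → Carrier) → N ≤ M → (∀ k → N < k → f k ≈ 0#) →
                         sumTo M f ≈ sumTo N f
  sumTo-vanishing-tail {N} f N≤M vanish = go (≤⇒≤′ N≤M)
    where
    go : ∀ {M} → N ≤′ M → sumTo M f ≈ sumTo N f
    go (≤′-reflexive ≡.refl) = refl
    go (≤′-step {M} N≤′M)  = trans (sumTo-suc-vanish M (vanish (suc M) (s≤s (≤′⇒≤ N≤′M)))) (go N≤′M)

  sumTo-split : ∀ N {f g h : ℕ → Carrier} {a} → f 0 ≈ g 0 → (∀ j → f (suc j) ≈ g (suc j) + a * h j) →
                sumTo (suc N) f ≈ sumTo (suc N) g + a * sumTo N h
  sumTo-split N {f} {g} {h} {a} f0≈g0 f≈g+ah = begin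
    sumTo (suc N) f                                          ≈⟨ sumTo-suc N f ⟩
    f 0 + sumTo N (λ j → f (suc j))                          ≈⟨ +-cong f0≈g0 (sumTo-cong N f≈g+ah) ⟩
    g 0 + sumTo N (λ j → g (suc j) + a * h j)                ≈⟨ +-congˡ (sumTo-linear N (λ j → g (suc j)) h a) ⟩
    g 0 + (sumTo N (λ j → g (suc j)) + a * sumTo N h)        ≈⟨ +-assoc _ _ _ ⟨
    (g 0 + sumTo N (λ j → g (suc j))) + a * sumTo N h        ≈⟨ +-congʳ (sumTo-suc N g) ⟨
    sumTo (suc N) g + a * sumTo N h                          ∎

  qbinom-vanish : ∀ {r k} → r < k → qbinom r k ≈ 0#
  qbinom-vanish {zero}  {suc k} _         = refl
  qbinom-vanish {suc r} {suc k} (s≤s r<k) = begin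
    qbinom r k + pow q (suc k) * qbinom r (suc k)   ≈⟨ +-cong (qbinom-vanish r<k) (*-congˡ (qbinom-vanish (m<n⇒m<1+n r<k))) ⟩
    0# + pow q (suc k) * 0#                         ≈⟨ trans (+-identityˡ _) (zeroʳ _) ⟩
    0#                                              ∎

  qbinom-diag : ∀ k → qbinom k k ≈ 1#
  qbinom-diag zero    = refl
  qbinom-diag (suc k) = begin
    qbinom k k + pow q (suc k) * qbinom k (suc k)   ≈⟨ +-cong (qbinom-diag k) (*-congˡ (qbinom-vanish (n<1+n k))) ⟩
    1# + pow q (suc k) * 0#                         ≈⟨ trans (+-congˡ (zeroʳ _)) (+-identityʳ _) ⟩
    1#                                              ∎

  qbinom-pascal′ : ∀ j k → qbinom (suc (j ℕ.+ k)) (suc k) ≈ pow q j * qbinom (j ℕ.+ k) k + qbinom (j ℕ.+ k) (suc k)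
  qbinom-pascal′ zero k = begin
    qbinom (suc k) (suc k)                    ≈⟨ qbinom-diag (suc k) ⟩
    1#                                        ≈⟨ trans (*-identityˡ _) (qbinom-diag k) ⟨
    1# * qbinom k k                           ≈⟨ +-identityʳ _ ⟨
    1# * qbinom k k + 0#                      ≈⟨ +-congˡ (qbinom-vanish (n<1+n k)) ⟨
    1# * qbinom k k + qbinom k (suc k)        ∎
  qbinom-pascal′ (suc j) zero = begin
    1# + (q * 1#) * qbinom (suc N) 1                   ≈⟨ +-congˡ (*-congˡ (qbinom-pascal′ j zero)) ⟩
    1# + (q * 1#) * (pow q j * 1# + qbinom N 1)        ≈⟨ solve 3 (λ q Q B → con 1 :+ (q :* con 1) :* (Q :* con 1 :+ B)
                                                                := q :* Q :* con 1 :+ (con 1 :+ (q :* con 1) :* B))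
                                                           refl q (pow q j) (qbinom N 1) ⟩
    (q * pow q j) * 1# + (1# + (q * 1#) * qbinom N 1)  ∎
    where N = j ℕ.+ zero
  qbinom-pascal′ (suc j) (suc k) = begin
    qbinom (suc N) (suc k) + Q₂ * qbinom (suc N) (suc (suc k))
      ≈⟨ +-cong pascal-at-suc-j (*-congˡ (qbinom-pascal′ j (suc k))) ⟩
    (q * pow q j * A + B) + Q₂ * (pow q j * B + C)
      ≈⟨ solve 6 (λ q Qj Qk A B C → (q :* Qj :* A :+ B) :+ q :* (q :* Qk) :* (Qj :* B :+ C)
                   := q :* Qj :* (A :+ q :* Qk :* B) :+ (B :+ q :* (q :* Qk) :* C))
                 refl q (pow q j) (pow q k) A B C ⟩
    pow q (suc j) * (A + pow q (suc k) * B) + (B + Q₂ * C)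
      ∎
    where
    N = j ℕ.+ suc k
    A = qbinom N k
    B = qbinom N (suc k)
    C = qbinom N (suc (suc k))
    Q₂ = pow q (suc (suc k))
    pascal-at-suc-j : qbinom (suc N) (suc k) ≈ pow q (suc j) * A + B
    pascal-at-suc-j = ≡.subst (λ x → qbinom (suc x) (suc k) ≈ pow q (suc j) * qbinom x k + qbinom x (suc k))
                              (≡.sym (+-suc j k)) (qbinom-pascal′ (suc j) k)

  qbinom-pascal-∸ : ∀ m {j k} → j ≤ k →
                    qbinom (suc m ℕ.∸ j) (suc k) ≈ qbinom (m ℕ.∸ j) k + pow q (suc k) * qbinom (m ℕ.∸ j) (suc k)
  qbinom-pascal-∸ m       {zero}          _   = refl
  qbinom-pascal-∸ zero    {suc j} {suc k} _   rewrite 0∸n≡0 j = sym (trans (+-identityˡ _) (zeroʳ _))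
  qbinom-pascal-∸ (suc m) {suc j}         j<k = qbinom-pascal-∸ m (<⇒≤ j<k)

  -- Multiplied by q^(2j) so that the factor q^(m-2j) of the second Pascal rule becomes q^m.
  qbinom-pascal′-∸ : ∀ m j → pow q (j ℕ.+ j) * qbinom (suc m ℕ.∸ j) (suc j)
                             ≈ pow q (j ℕ.+ j) * qbinom (m ℕ.∸ j) (suc j) + pow q m * qbinom (m ℕ.∸ j) j
  qbinom-pascal′-∸ m j with j ℕ.+ j ≤? m
  qbinom-pascal′-∸ m j | yes 2j≤m with m≤n⇒∃[o]m+o≡n 2j≤m
  qbinom-pascal′-∸ _ j | yes _ | s , ≡.refl = begin
    Q₂ⱼ * qbinom (suc (j ℕ.+ j ℕ.+ s) ℕ.∸ j) (suc j)
      ≡⟨ cong (λ x → Q₂ⱼ * qbinom x (suc j)) ([1+m+m+n]∸m≡1+n+m j s) ⟩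
    Q₂ⱼ * qbinom (suc (s ℕ.+ j)) (suc j)
      ≈⟨ *-congˡ (qbinom-pascal′ s j) ⟩
    Q₂ⱼ * (pow q s * A + B)
      ≈⟨ solve 4 (λ Q₂ⱼ Qs A B → Q₂ⱼ :* (Qs :* A :+ B) := Q₂ⱼ :* B :+ (Q₂ⱼ :* Qs) :* A) refl Q₂ⱼ (pow q s) A B ⟩
    Q₂ⱼ * B + (Q₂ⱼ * pow q s) * A
      ≈⟨ +-congˡ (*-congʳ (pow-+ q (j ℕ.+ j) s)) ⟨
    Q₂ⱼ * B + pow q (j ℕ.+ j ℕ.+ s) * A
      ≡⟨ cong (λ x → Q₂ⱼ * qbinom x (suc j) + pow q (j ℕ.+ j ℕ.+ s) * qbinom x j) ([m+m+n]∸m≡n+m j s) ⟨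
    Q₂ⱼ * qbinom (j ℕ.+ j ℕ.+ s ℕ.∸ j) (suc j) + pow q (j ℕ.+ j ℕ.+ s) * qbinom (j ℕ.+ j ℕ.+ s ℕ.∸ j) j
      ∎
    where
    Q₂ⱼ = pow q (j ℕ.+ j)
    A = qbinom (s ℕ.+ j) j
    B = qbinom (s ℕ.+ j) (suc j)
  qbinom-pascal′-∸ m zero      | no 0≰m = contradiction z≤n 0≰m
  qbinom-pascal′-∸ m j@(suc _) | no 2j≰m = begin
    Q₂ⱼ * qbinom (suc m ℕ.∸ j) (suc j)                                 ≈⟨ *-congˡ (qbinom-vanish [1+m]∸j<1+j) ⟩
    Q₂ⱼ * 0#                                                           ≈⟨ +-identityʳ _ ⟨
    Q₂ⱼ * 0# + 0#                                                      ≈⟨ +-congˡ (zeroʳ _) ⟨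
    Q₂ⱼ * 0# + pow q m * 0#                                            ≈⟨ +-cong (*-congˡ (qbinom-vanish (m<n⇒m<1+n m∸j<j)))
                                                                                 (*-congˡ (qbinom-vanish m∸j<j)) ⟨
    Q₂ⱼ * qbinom (m ℕ.∸ j) (suc j) + pow q m * qbinom (m ℕ.∸ j) j       ∎
    where
    Q₂ⱼ = pow q (j ℕ.+ j)
    m<2j : m < j ℕ.+ j
    m<2j = ≰⇒> 2j≰m
    m∸j<j : m ℕ.∸ j < j
    m∸j<j = m<n+o⇒m∸n<o m j m<2j
    [1+m]∸j<1+j : suc m ℕ.∸ j < suc j
    [1+m]∸j<1+j = s≤s (m≤n+o⇒m∸n≤o (suc m) j m<2j)

  term : (ℕ → ℕ) → ℕ → ℕ → Carrier
  term w n k = sgn k * qbinom (n ℕ.∸ k) k * pow q (w k)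

  term-vanish : ∀ w {n k} → n ℕ.∸ k < k → term w n k ≈ 0#
  term-vanish w n∸k<k = trans (*-congʳ (trans (*-congˡ (qbinom-vanish n∸k<k)) (zeroʳ _))) (zeroˡ _)

  term-vanish-suc : ∀ w n → term w n (suc n) ≈ 0#
  term-vanish-suc w n = term-vanish w {n} (s≤s (m∸n≤m n (suc n)))

  -- Summing to n rather than ⌊n/2⌋ lets the upper limits of the recurrences below shift uniformly.
  T U : ℕ → Carrier
  T n = sumTo n (term triangle n)
  U n = sumTo n (term triangle⁺ n)

  pow-triangle-2+ : ∀ j → pow q (triangle (2 ℕ.+ j)) ≈ q * (pow q (j ℕ.+ j) * pow q (triangle j))
  pow-triangle-2+ j = *-congˡ (trans (reflexive (cong (pow q) (≡.sym (ℕₚ.+-assoc j j (triangle j)))))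
                                     (pow-+ q (j ℕ.+ j) (triangle j)))

  T-U-recurrence : ∀ m → T (2 ℕ.+ m) ≈ U (1 ℕ.+ m) + -1# * U m
  T-U-recurrence m = begin
    T (2 ℕ.+ m)                                                   ≈⟨ sumTo-split (1 ℕ.+ m) refl termwise ⟩
    sumTo (2 ℕ.+ m) (term triangle⁺ (1 ℕ.+ m)) + -1# * sumTo (1 ℕ.+ m) (term triangle⁺ m)
      ≈⟨ +-cong (sumTo-suc-vanish (1 ℕ.+ m) (term-vanish-suc triangle⁺ (1 ℕ.+ m)))
                (*-congˡ (sumTo-suc-vanish m (term-vanish-suc triangle⁺ m))) ⟩
    U (1 ℕ.+ m) + -1# * U m                                       ∎
    where
    termwise : ∀ j → term triangle (2 ℕ.+ m) (suc j) ≈ term triangle⁺ (1 ℕ.+ m) (suc j) + -1# * term triangle⁺ m j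
    termwise j = begin
      sgn (suc j) * qbinom (suc m ℕ.∸ j) (suc j) * P            ≈⟨ *-congʳ (*-cong (sgn-suc j) (qbinom-pascal-∸ m (ℕₚ.≤-refl {j}))) ⟩
      (-1# * s) * (B₀ + Q * B₁) * P                             ≈⟨ solve 6 (λ e s B₀ B₁ Q P → (e :* s) :* (B₀ :+ Q :* B₁) :* P
                                                                             := (e :* s) :* B₁ :* (Q :* P) :+ e :* (s :* B₀ :* P))
                                                                      refl -1# s B₀ B₁ Q P ⟩
      (-1# * s) * B₁ * (Q * P) + -1# * (s * B₀ * P)             ≈⟨ +-congʳ (*-cong (*-congʳ (sgn-suc j)) (pow-+ q (suc j) (triangle⁺ j))) ⟨
      sgn (suc j) * B₁ * pow q (triangle⁺ (suc j)) + -1# * (s * B₀ * P) ∎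
      where
      s = sgn j
      P = pow q (triangle⁺ j)
      Q = pow q (suc j)
      B₀ = qbinom (m ℕ.∸ j) j
      B₁ = qbinom (m ℕ.∸ j) (suc j)

  U-T-recurrence : ∀ m → U (2 ℕ.+ m) ≈ U (1 ℕ.+ m) + (-1# * pow q (suc m)) * T m
  U-T-recurrence m = begin
    U (2 ℕ.+ m)                                                   ≈⟨ sumTo-split (1 ℕ.+ m) refl termwise ⟩
    sumTo (2 ℕ.+ m) (term triangle⁺ (1 ℕ.+ m)) + (-1# * pow q (suc m)) * sumTo (1 ℕ.+ m) (term triangle m)
      ≈⟨ +-cong (sumTo-suc-vanish (1 ℕ.+ m) (term-vanish-suc triangle⁺ (1 ℕ.+ m)))
                (*-congˡ (sumTo-suc-vanish m (term-vanish-suc triangle m))) ⟩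
    U (1 ℕ.+ m) + (-1# * pow q (suc m)) * T m                     ∎
    where
    termwise : ∀ j → term triangle⁺ (2 ℕ.+ m) (suc j)
                     ≈ term triangle⁺ (1 ℕ.+ m) (suc j) + (-1# * pow q (suc m)) * term triangle m j
    termwise j = begin
      sgn (suc j) * C * pow q (triangle (2 ℕ.+ j))              ≈⟨ *-cong (*-congʳ (sgn-suc j)) (pow-triangle-2+ j) ⟩
      (-1# * s) * C * (q * (Q₂ⱼ * P))                           ≈⟨ solve 6 (λ e s C q Q₂ⱼ P → (e :* s) :* C :* (q :* (Q₂ⱼ :* P))
                                                                             := (e :* s :* q :* P) :* (Q₂ⱼ :* C))
                                                                      refl -1# s C q Q₂ⱼ P ⟩
      (-1# * s * q * P) * (Q₂ⱼ * C)                             ≈⟨ *-congˡ (qbinom-pascal′-∸ m j) ⟩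
      (-1# * s * q * P) * (Q₂ⱼ * B₁ + Qₘ * B₀)                  ≈⟨ solve 8 (λ e s q P Q₂ⱼ B₁ Qₘ B₀ → (e :* s :* q :* P) :* (Q₂ⱼ :* B₁ :+ Qₘ :* B₀)
                                                                             := (e :* s) :* B₁ :* (q :* (Q₂ⱼ :* P)) :+ (e :* (q :* Qₘ)) :* (s :* B₀ :* P))
                                                                      refl -1# s q P Q₂ⱼ B₁ Qₘ B₀ ⟩
      (-1# * s) * B₁ * (q * (Q₂ⱼ * P)) + (-1# * (q * Qₘ)) * (s * B₀ * P)
                                                                ≈⟨ +-congʳ (*-cong (*-congʳ (sgn-suc j)) (pow-triangle-2+ j)) ⟨
      sgn (suc j) * B₁ * pow q (triangle (2 ℕ.+ j)) + (-1# * (q * Qₘ)) * (s * B₀ * P) ∎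
      where
      s = sgn j
      P = pow q (triangle j)
      Q₂ⱼ = pow q (j ℕ.+ j)
      Qₘ = pow q m
      C = qbinom (suc m ℕ.∸ j) (suc j)
      B₀ = qbinom (m ℕ.∸ j) j
      B₁ = qbinom (m ℕ.∸ j) (suc j)

  T-quasiperiodic : ∀ m → T (3 ℕ.+ m) ≈ -1# * (pow q (suc m) * T m)
  T-quasiperiodic m = begin
    T (3 ℕ.+ m)                                             ≈⟨ T-U-recurrence (suc m) ⟩
    U (2 ℕ.+ m) + -1# * U (1 ℕ.+ m)                         ≈⟨ +-congʳ (U-T-recurrence m) ⟩
    (U (1 ℕ.+ m) + (-1# * Q) * T m) + -1# * U (1 ℕ.+ m)     ≈⟨ solve 4 (λ u e Q t → (u :+ (e :* Q) :* t) :+ e :* u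
                                                                          := (u :+ e :* u) :+ e :* (Q :* t))
                                                                   refl (U (1 ℕ.+ m)) -1# Q (T m) ⟩
    (U (1 ℕ.+ m) + -1# * U (1 ℕ.+ m)) + -1# * (Q * T m)     ≈⟨ +-congʳ (x+-1#*x≈0# _) ⟩
    0# + -1# * (Q * T m)                                    ≈⟨ +-identityˡ _ ⟩
    -1# * (Q * T m)                                         ∎
    where Q = pow q (suc m)

  1#*1#*1#≈1# : 1# * 1# * 1# ≈ 1#
  1#*1#*1#≈1# = trans (*-identityʳ _) (*-identityʳ _)

  T-0 : T 0 ≈ 1#
  T-0 = 1#*1#*1#≈1#

  T-1 : T 1 ≈ 1#
  T-1 = trans (sumTo-suc-vanish 0 {term triangle 1} (term-vanish triangle {1} {1} (s≤s z≤n))) 1#*1#*1#≈1#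

  T-2 : T 2 ≈ 0#
  T-2 = begin
    T 2                ≈⟨ T-U-recurrence 0 ⟩
    U 1 + -1# * U 0    ≈⟨ +-cong U-1 (*-congˡ 1#*1#*1#≈1#) ⟩
    1# + -1# * 1#      ≈⟨ x+-1#*x≈0# 1# ⟩
    0#                 ∎
    where
    U-1 : U 1 ≈ 1#
    U-1 = trans (sumTo-suc-vanish 0 {term triangle⁺ 1} (term-vanish triangle⁺ {1} {1} (s≤s z≤n))) 1#*1#*1#≈1#

  -- The claimed recurrence at n = 2 + k, with the subtracted term moved left so the semiring solver applies.
  RecurrenceAt : ℕ → Set ℓ
  RecurrenceAt k = T (2 ℕ.+ k) + pow q (2 ℕ.* (2 ℕ.+ k) / 3 ℕ.∸ 1) * T k ≈ pow q ((2 ℕ.+ k) / 3) * T (1 ℕ.+ k)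

  RecurrenceAt-+3 : ∀ k → RecurrenceAt k → RecurrenceAt (3 ℕ.+ k)
  RecurrenceAt-+3 k rec = begin
    T (5 ℕ.+ k) + pow q (2 ℕ.* (5 ℕ.+ k) / 3 ℕ.∸ 1) * T (3 ℕ.+ k)
      ≡⟨ cong (λ e → T (5 ℕ.+ k) + pow q e * T (3 ℕ.+ k)) ([2*[5+k]]/3∸1≡2+[[2*[2+k]]/3∸1] k) ⟩
    T (5 ℕ.+ k) + pow q (2 ℕ.+ b) * T (3 ℕ.+ k)
      ≈⟨ +-cong (T-quasiperiodic (2 ℕ.+ k)) (*-congˡ (T-quasiperiodic k)) ⟩
    -1# * (pow q (3 ℕ.+ k) * T (2 ℕ.+ k)) + pow q (2 ℕ.+ b) * (-1# * (pow q (1 ℕ.+ k) * T k))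
      ≈⟨ solve 6 (λ e q Qₖ Q_b X Y → e :* ((q :* (q :* (q :* Qₖ))) :* X) :+ (q :* (q :* Q_b)) :* (e :* ((q :* Qₖ) :* Y))
                   := e :* (q :* (q :* (q :* Qₖ))) :* (X :+ Q_b :* Y))
                 refl -1# q (pow q k) (pow q b) (T (2 ℕ.+ k)) (T k) ⟩
    -1# * pow q (3 ℕ.+ k) * (T (2 ℕ.+ k) + pow q b * T k)
      ≈⟨ *-congˡ rec ⟩
    -1# * pow q (3 ℕ.+ k) * (pow q a * T (1 ℕ.+ k))
      ≈⟨ solve 5 (λ e q Qₖ Qₐ Z → e :* (q :* (q :* (q :* Qₖ))) :* (Qₐ :* Z)
                   := (q :* Qₐ) :* (e :* ((q :* (q :* Qₖ)) :* Z)))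
                 refl -1# q (pow q k) (pow q a) (T (1 ℕ.+ k)) ⟩
    pow q (suc a) * (-1# * (pow q (2 ℕ.+ k) * T (1 ℕ.+ k)))
      ≈⟨ *-congˡ (T-quasiperiodic (1 ℕ.+ k)) ⟨
    pow q (suc a) * T (4 ℕ.+ k)
      ≡⟨ cong (λ e → pow q e * T (4 ℕ.+ k)) ([3+m]/3≡1+[m/3] (2 ℕ.+ k)) ⟨
    pow q ((5 ℕ.+ k) / 3) * T (4 ℕ.+ k)
      ∎
    where
    a = (2 ℕ.+ k) / 3
    b = 2 ℕ.* (2 ℕ.+ k) / 3 ℕ.∸ 1

  T-recurrence : ∀ k → RecurrenceAt k
  T-recurrence 0 = begin
    T 2 + 1# * T 0                    ≈⟨ +-cong T-2 (*-congˡ T-0) ⟩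
    0# + 1# * 1#                      ≈⟨ +-identityˡ _ ⟩
    1# * 1#                           ≈⟨ *-congˡ T-1 ⟨
    1# * T 1                          ∎
  T-recurrence 1 = begin
    T 3 + q¹ * T 1                    ≈⟨ +-cong (T-quasiperiodic 0) (*-congˡ T-1) ⟩
    -1# * (q¹ * T 0) + q¹ * 1#        ≈⟨ +-congʳ (*-congˡ (*-congˡ T-0)) ⟩
    -1# * (q¹ * 1#) + q¹ * 1#         ≈⟨ +-comm _ _ ⟩
    q¹ * 1# + -1# * (q¹ * 1#)         ≈⟨ x+-1#*x≈0# _ ⟩
    0#                                ≈⟨ zeroʳ _ ⟨
    q¹ * 0#                           ≈⟨ *-congˡ T-2 ⟨
    q¹ * T 2                          ∎
    where q¹ = pow q 1
  T-recurrence 2 = begin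
    T 4 + q¹ * T 2                    ≈⟨ +-cong (T-quasiperiodic 1) (*-congˡ T-2) ⟩
    -1# * (pow q 2 * T 1) + q¹ * 0#   ≈⟨ solve 3 (λ e q t → e :* ((q :* (q :* con 1)) :* t) :+ (q :* con 1) :* con 0
                                                         := (q :* con 1) :* (e :* ((q :* con 1) :* t)))
                                                  refl -1# q (T 1) ⟩
    q¹ * (-1# * (q¹ * T 1))           ≈⟨ *-congˡ (*-congˡ (*-congˡ (trans T-1 (sym T-0)))) ⟩
    q¹ * (-1# * (q¹ * T 0))           ≈⟨ *-congˡ (T-quasiperiodic 0) ⟨
    q¹ * T 3                          ∎
    where q¹ = pow q 1
  T-recurrence (suc (suc (suc k))) = RecurrenceAt-+3 k (T-recurrence k)

  S≈T : ∀ n → S n ≈ T n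
  S≈T n = begin
    S n                               ≈⟨ sumTo-cong (n / 2) (λ k → *-congˡ (reflexive (cong (pow q) (k*[k∸1]/2≡triangle k)))) ⟩
    sumTo (n / 2) (term triangle n)   ≈⟨ sumTo-vanishing-tail (term triangle n) (m/n≤m n 2)
                                           (λ k n/2<k → term-vanish triangle (m/2<n⇒m∸n<n n/2<k)) ⟨
    T n                               ∎

  S-recurrence : ∀ k → S (2 ℕ.+ k) ≈ pow q ((2 ℕ.+ k) / 3) * S (1 ℕ.+ k) - pow q (2 ℕ.* (2 ℕ.+ k) / 3 ℕ.∸ 1) * S k
  S-recurrence k = begin
    S (2 ℕ.+ k)                                 ≈⟨ S≈T (2 ℕ.+ k) ⟩
    T (2 ℕ.+ k)                                 ≈⟨ //-rightDividesʳ (Q_b * T k) (T (2 ℕ.+ k)) ⟨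
    T (2 ℕ.+ k) + Q_b * T k - Q_b * T k         ≈⟨ +-congʳ (T-recurrence k) ⟩
    Qₐ * T (1 ℕ.+ k) - Q_b * T k                ≈⟨ +-cong (*-congˡ (S≈T (1 ℕ.+ k))) (-‿cong (*-congˡ (S≈T k))) ⟨
    Qₐ * S (1 ℕ.+ k) - Q_b * S k                ∎
    where
    Qₐ = pow q ((2 ℕ.+ k) / 3)
    Q_b = pow q (2 ℕ.* (2 ℕ.+ k) / 3 ℕ.∸ 1)

mainTheorem5 : ∀ {c ℓ : Level} (R : CommutativeRing c ℓ) (q : CommutativeRing.Carrier R)
    → ∀ (n : ℕ) → 2 ≤ n
    → let open CommutativeRing R
          open QDefs R q
      in S n ≈ pow q (n / 3) * S (n ℕ.∸ 1) - pow q ((2 ℕ.* n) / 3 ℕ.∸ 1) * S (n ℕ.∸ 2)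
mainTheorem5 R q (suc (suc k)) (s≤s (s≤s _)) = S-recurrence R q k
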